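{- Let $a\le b$ be positive integers and let $G$ be a $K_{a,b}$-free graph with minimum degree $\delta \geq 4a-4$. Then $$Z(G) \geq \frac{1}{2}\left(\frac{\delta}{4(b-1)^{1/a}}\right)^{\frac{a}{a-1}}.$$
   Context: $K_{a,b}$ is the complete bipartite graph with parts of sizes $a$ and $b$; $G$ is $K_{a,b}$-free if it contains no subgraph isomorphic to $K_{a,b}$. Zero forcing process on a graph $G$: initially a set $S$ of vertices is black, all others white; at each step, a black vertex with exactly one white neighbour forces that neighbour to become black. $S$ is a zero forcing set if eventually all vertices become black. $Z(G)$ is the minimum cardinality of a zero forcing set. -}

module Defs where

open import Data.Nat using (ℕ; _≤_)
open import Data.Bool using (Bool; true; false)
open import Data.Fin using (Fin)
open import Data.Fin.Subset using (Subset; _∈_; ∣_∣)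
open import Data.Vec using (tabulate)
open import Data.Product using (Σ; ∃; _×_)
open import Relation.Binary.PropositionalEquality using (_≡_; _≢_)
open import Function.Definitions using (Injective)
open import Relation.Nullary using (¬_)

record Graph : Set where
  field
    n      : ℕ
    adj    : Fin n → Fin n → Bool
    sym    : ∀ u v → adj u v ≡ adj v u
    irrefl : ∀ v → adj v v ≡ false

module _ (G : Graph) where
  open Graph G

  Adjacent : Fin n → Fin n → Set
  Adjacent u v = adj u v ≡ true

  nbhd : Fin n → Subset n
  nbhd v = tabulate (adj v)

  degree : Fin n → ℕ
  degree v = ∣ nbhd v ∣

  IsMinDegree : ℕ → Set
  IsMinDegree δ = (∃ λ v → degree v ≡ δ) × (∀ v → δ ≤ degree v)

  ContainsKab : ℕ → ℕ → Set
  ContainsKab a b =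
    Σ (Fin a → Fin n) λ f → Σ (Fin b → Fin n) λ g →
      Injective _≡_ _≡_ f × Injective _≡_ _≡_ g ×
      (∀ i j → f i ≢ g j) × (∀ i j → Adjacent (f i) (g j))

  KabFree : ℕ → ℕ → Set
  KabFree a b = ¬ ContainsKab a b

  -- Vertices that end up black when the zero forcing process starts from S
  -- (the final colouring is the least set containing S closed under the
  -- colour-change rule: a black u all of whose neighbours other than v are
  -- black forces its neighbour v).
  data Black (S : Subset n) : Fin n → Set where
    initial : ∀ {v} → v ∈ S → Black S v
    force   : ∀ {u v} → Black S u → Adjacent u v →
              (∀ w → Adjacent u w → w ≢ v → Black S w) → Black S v

  IsZeroForcingSet : Subset n → Set
  IsZeroForcingSet S = ∀ v → Black S v

  IsZeroForcingNumber : ℕ → Set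
  IsZeroForcingNumber z =
    (Σ (Subset n) λ S → IsZeroForcingSet S × ∣ S ∣ ≡ z) ×
    (∀ S → IsZeroForcingSet S → z ≤ ∣ S ∣)

module Submission where

-- Run a zero forcing set S with |S| = Z for Z steps (or, when n < 2Z, take the
-- whole vertex set): this yields a nonempty set U of vertices whose
-- neighbourhoods lie in a set X with |X| ≤ 2|U| and |X| ≤ 2Z. Each u ∈ U has at
-- least δ neighbours in X, so it is the common neighbour of at least δ↓a
-- ordered a-tuples of distinct vertices of X, while K_{a,b}-freeness lets each
-- such tuple have at most b - 1 common neighbours:
-- |U| · δ↓a ≤ (b - 1) |X|^a ≤ (b - 1) · 2|U| · (2Z)^(a-1).
-- Finally δ ≥ 4(a - 1) makes every factor δ - j of δ↓a at least δ/4.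

open import Defs
open import Data.Nat using (ℕ; _≤_; _*_; _∸_; _^_)

open import Data.Bool.Base using (Bool; true; false; _∧_)
import Data.Bool.Properties as Bool
open import Data.Empty using (⊥-elim)
open import Data.Fin.Base using (Fin; zero; suc)
open import Data.Fin.Properties using (_≟_; suc-injective; any?; all?; toℕ<n)
open import Data.Fin.Subset
open import Data.Fin.Subset.Properties
open import Data.Nat.Base using (zero; suc; _+_; _<_; z≤n; s≤s; >-nonZero)
open import Data.Nat.Properties hiding (_≟_; suc-injective)
open import Data.Nat.Solver using (module +-*-Solver)
open import Data.Product using (Σ; ∃₂; _×_; _,_)
open import Data.Sum using (inj₁; inj₂)
open import Data.Vec.Base using ([]; _∷_; lookup; here; there)
import Data.Vec.Functional as Vector
open import Data.Vec.Properties using (lookup-zipWith; lookup∘tabulate; lookup⇒[]=; []=⇒lookup)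
open import Function.Base using (_∘_)
open import Function.Definitions using (Injective)
open import Relation.Binary.PropositionalEquality
open import Relation.Nullary using (¬_; Dec; yes; no; ¬?; _×-dec_; _→-dec_)

open +-*-Solver

open import Algebra.Properties.CommutativeSemigroup *-commutativeSemigroup using (x∙yz≈y∙xz)
open import Algebra.Properties.Semiring.Sum +-*-semiring
  using (sum; sum-syntax; sum-cong-≗; ∑-comm; *-distribˡ-sum; *-distribʳ-sum)

𝟙 : Bool → ℕ
𝟙 true  = 1
𝟙 false = 0

𝟙-∧ : ∀ s t → 𝟙 (s ∧ t) ≡ 𝟙 s * 𝟙 t
𝟙-∧ true  t = sym (+-identityʳ (𝟙 t))
𝟙-∧ false t = refl

module _ {n : ℕ} where

  ∑∈ : Subset n → (Fin n → ℕ) → ℕ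
  ∑∈ p f = ∑[ x < n ] (𝟙 (lookup p x) * f x)

  syntax ∑∈ p (λ x → e) = ∑[ x ∈ p ] e

∣p∣≡∑𝟙 : ∀ {n} (p : Subset n) → ∣ p ∣ ≡ ∑[ x < n ] 𝟙 (lookup p x)
∣p∣≡∑𝟙 []            = refl
∣p∣≡∑𝟙 (inside  ∷ p) = cong suc (∣p∣≡∑𝟙 p)
∣p∣≡∑𝟙 (outside ∷ p) = ∣p∣≡∑𝟙 p

module _ {n : ℕ} (p : Subset n) where

  ∑∈-const : ∀ k → ∑[ x ∈ p ] k ≡ ∣ p ∣ * k
  ∑∈-const k = begin
    ∑[ x < n ] (𝟙 (lookup p x) * k)  ≡⟨ *-distribʳ-sum k (λ x → 𝟙 (lookup p x)) ⟨
    (∑[ x < n ] 𝟙 (lookup p x)) * k  ≡⟨ cong (_* k) (∣p∣≡∑𝟙 p) ⟨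
    ∣ p ∣ * k                        ∎
    where open ≡-Reasoning

  ∑∈-distribʳ : ∀ (f : Fin n → ℕ) k → (∑[ x ∈ p ] f x) * k ≡ ∑[ x ∈ p ] (f x * k)
  ∑∈-distribʳ f k = trans (*-distribʳ-sum k (λ x → 𝟙 (lookup p x) * f x))
    (sum-cong-≗ {n} λ x → *-assoc (𝟙 (lookup p x)) (f x) k)

  ∑∈-mono-≤ : ∀ {f g : Fin n → ℕ} → (∀ {x} → x ∈ p → f x ≤ g x) → ∑[ x ∈ p ] f x ≤ ∑[ x ∈ p ] g x
  ∑∈-mono-≤ {f} {g} f≤g = sum-mono-≤ λ x → term x (lookup p x) refl
    where
    sum-mono-≤ : ∀ {m} {u v : Fin m → ℕ} → (∀ x → u x ≤ v x) → sum u ≤ sum v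
    sum-mono-≤ {zero}  u≤v = z≤n
    sum-mono-≤ {suc m} u≤v = +-mono-≤ (u≤v zero) (sum-mono-≤ (λ x → u≤v (suc x)))
    term : ∀ x s → lookup p x ≡ s → 𝟙 s * f x ≤ 𝟙 s * g x
    term x true  px = *-monoʳ-≤ 1 (f≤g (lookup⇒[]= x p px))
    term x false _  = z≤n

∣p∪q∣≤∣p∣+∣q∣ : ∀ {n} (p q : Subset n) → ∣ p ∪ q ∣ ≤ ∣ p ∣ + ∣ q ∣
∣p∪q∣≤∣p∣+∣q∣ []            []            = z≤n
∣p∪q∣≤∣p∣+∣q∣ (inside  ∷ p) (outside ∷ q) = s≤s (∣p∪q∣≤∣p∣+∣q∣ p q)
∣p∪q∣≤∣p∣+∣q∣ (inside  ∷ p) (inside  ∷ q) =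
  s≤s (≤-trans (∣p∪q∣≤∣p∣+∣q∣ p q) (+-monoʳ-≤ ∣ p ∣ (n≤1+n ∣ q ∣)))
∣p∪q∣≤∣p∣+∣q∣ (outside ∷ p) (inside  ∷ q) =
  ≤-trans (s≤s (∣p∪q∣≤∣p∣+∣q∣ p q)) (≤-reflexive (sym (+-suc ∣ p ∣ ∣ q ∣)))
∣p∪q∣≤∣p∣+∣q∣ (outside ∷ p) (outside ∷ q) = ∣p∪q∣≤∣p∣+∣q∣ p q

∣p∪⁅x⁆∣≤1+∣p∣ : ∀ {n} (p : Subset n) x → ∣ p ∪ ⁅ x ⁆ ∣ ≤ suc ∣ p ∣
∣p∪⁅x⁆∣≤1+∣p∣ p x = begin
  ∣ p ∪ ⁅ x ⁆ ∣      ≤⟨ ∣p∪q∣≤∣p∣+∣q∣ p ⁅ x ⁆ ⟩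
  ∣ p ∣ + ∣ ⁅ x ⁆ ∣  ≡⟨ cong (∣ p ∣ +_) (∣⁅x⁆∣≡1 x) ⟩
  ∣ p ∣ + 1          ≡⟨ +-comm ∣ p ∣ 1 ⟩
  suc ∣ p ∣          ∎
  where open ≤-Reasoning

x∉p⇒∣p∣<∣p∪⁅x⁆∣ : ∀ {n} {p : Subset n} {x} → x ∉ p → ∣ p ∣ < ∣ p ∪ ⁅ x ⁆ ∣
x∉p⇒∣p∣<∣p∪⁅x⁆∣ {p = p} {x} x∉p =
  p⊂q⇒∣p∣<∣q∣ (p⊆p∪q ⁅ x ⁆ , x , x∈p∪q⁺ (inj₂ (x∈⁅x⁆ x)) , x∉p)

∣p∩q∣≤1+∣[p-x]∩q∣ : ∀ {n} (p q : Subset n) x → ∣ p ∩ q ∣ ≤ suc ∣ (p - x) ∩ q ∣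
∣p∩q∣≤1+∣[p-x]∩q∣ p q x = ≤-trans (p⊆q⇒∣p∣≤∣q∣ split) (∣p∪⁅x⁆∣≤1+∣p∣ ((p - x) ∩ q) x)
  where
  split : p ∩ q ⊆ ((p - x) ∩ q) ∪ ⁅ x ⁆
  split {y} y∈p∩q with x∈p∩q⁻ p q y∈p∩q | y ≟ x
  ... | _         , _   | yes refl = x∈p∪q⁺ (inj₂ (x∈⁅x⁆ x))
  ... | y∈p , y∈q | no y≢x   = x∈p∪q⁺ (inj₁ (x∈p∩q⁺ (x∈p∧x≢y⇒x∈p-y y∈p y≢x , y∈q)))

injectionInto : ∀ {n m} (p : Subset n) → m ≤ ∣ p ∣ →
  Σ (Fin m → Fin n) λ f → Injective _≡_ _≡_ f × (∀ i → f i ∈ p)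
injectionInto {m = zero}  p             _   = (λ ()) , (λ { {()} }) , λ ()
injectionInto {m = suc m} (inside  ∷ p) m<∣p∣ with injectionInto p (≤-pred m<∣p∣)
... | f , f-inj , f∈p = f′ , f′-inj , f′∈p
  where
  f′ : Fin (suc m) → Fin _
  f′ zero    = zero
  f′ (suc i) = suc (f i)
  f′-inj : Injective _≡_ _≡_ f′
  f′-inj {zero}  {zero}  _ = refl
  f′-inj {suc i} {suc j} e = cong suc (f-inj (suc-injective e))
  f′∈p : ∀ i → f′ i ∈ inside ∷ p
  f′∈p zero    = here
  f′∈p (suc i) = there (f∈p i)
injectionInto {m = suc m} (outside ∷ p) m<∣p∣ with injectionInto p m<∣p∣
... | f , f-inj , f∈p = suc ∘ f , f-inj ∘ suc-injective , there ∘ f∈p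

x∉p-x : ∀ {n} (p : Subset n) x → x ∉ p - x
x∉p-x (s ∷ p) zero    ()
x∉p-x (s ∷ p) (suc x) (there x∈p-x) = x∉p-x p x x∈p-x

2*m≡m+m : ∀ m → 2 * m ≡ m + m
2*m≡m+m m = cong (m +_) (+-identityʳ m)

infix 8 _↓_

_↓_ : ℕ → ℕ → ℕ
d ↓ zero  = 1
d ↓ suc a = d * (d ∸ 1) ↓ a

d≤4*[d∸j] : ∀ d j → 4 * j ≤ d → d ≤ 4 * (d ∸ j)
d≤4*[d∸j] d j 4j≤d = begin
  d          ≡⟨ m+[n∸m]≡n j≤d ⟨
  j + e      ≤⟨ +-monoˡ-≤ e j≤e ⟩
  e + e      ≤⟨ +-monoʳ-≤ e (m≤m+n e (e + (e + 0))) ⟩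
  4 * e      ∎
  where
  open ≤-Reasoning
  e = d ∸ j
  j≤d : j ≤ d
  j≤d = ≤-trans (m≤m*n j 4) (≤-trans (≤-reflexive (*-comm j 4)) 4j≤d)
  j≤e : j ≤ e
  j≤e = +-cancelˡ-≤ j j e (begin
    j + j      ≤⟨ +-monoʳ-≤ j (m≤m+n j (j + (j + 0))) ⟩
    4 * j      ≤⟨ 4j≤d ⟩
    d          ≡⟨ m+[n∸m]≡n j≤d ⟨
    j + e      ∎)

^≤4^*↓ : ∀ a j d → 4 * (j + a) ≤ 4 + d → d ^ a ≤ 4 ^ a * (d ∸ j) ↓ a
^≤4^*↓ zero    j d _     = ≤-refl
^≤4^*↓ (suc a) j d bound = begin
  d * d ^ a                                  ≤⟨ *-mono-≤ (d≤4*[d∸j] d j 4j≤d) ih ⟩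
  4 * (d ∸ j) * (4 ^ a * (d ∸ j ∸ 1) ↓ a)    ≡⟨ solve 3 (λ e p f → con 4 :* e :* (p :* f) := con 4 :* p :* (e :* f))
                                                   refl (d ∸ j) (4 ^ a) ((d ∸ j ∸ 1) ↓ a) ⟩
  4 ^ suc a * (d ∸ j) ↓ suc a                ∎
  where
  open ≤-Reasoning
  4j≤d : 4 * j ≤ d
  4j≤d = +-cancelˡ-≤ 4 (4 * j) d (begin
    4 + 4 * j        ≡⟨ +-comm 4 (4 * j) ⟩
    4 * j + 4 * 1    ≡⟨ *-distribˡ-+ 4 j 1 ⟨
    4 * (j + 1)      ≤⟨ *-monoʳ-≤ 4 (+-monoʳ-≤ j (s≤s z≤n)) ⟩
    4 * (j + suc a)  ≤⟨ bound ⟩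
    4 + d            ∎)
  ih : d ^ a ≤ 4 ^ a * (d ∸ j ∸ 1) ↓ a
  ih = subst (λ e → d ^ a ≤ 4 ^ a * e ↓ a) (sym (∸-+-assoc d j 1))
         (^≤4^*↓ a (j + 1) d (subst (λ k → 4 * k ≤ 4 + d) (sym (+-assoc j 1 a)) bound))

4*^≤4^*↓ : ∀ a d → 4 * a ≤ d → 4 * d ^ suc a ≤ 4 ^ suc a * d ↓ suc a
4*^≤4^*↓ a d 4a≤d = begin
  4 * (d * d ^ a)                     ≤⟨ *-monoʳ-≤ 4 (*-monoʳ-≤ d (^≤4^*↓ a 1 d 4[1+a]≤4+d)) ⟩
  4 * (d * (4 ^ a * (d ∸ 1) ↓ a))     ≡⟨ solve 3 (λ d p f → con 4 :* (d :* (p :* f)) := con 4 :* p :* (d :* f))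
                                           refl d (4 ^ a) ((d ∸ 1) ↓ a) ⟩
  4 ^ suc a * d ↓ suc a               ∎
  where
  open ≤-Reasoning
  4[1+a]≤4+d : 4 * (1 + a) ≤ 4 + d
  4[1+a]≤4+d = ≤-trans (≤-reflexive (*-suc 4 a)) (+-monoʳ-≤ 4 4a≤d)

module _ (G : Graph) where
  open Graph G using (n; adj; irrefl) renaming (sym to adj-sym)

  Adjacent⇒∈nbhd : ∀ {u v} → Adjacent G u v → v ∈ nbhd G u
  Adjacent⇒∈nbhd {u} {v} uv = lookup⇒[]= v (nbhd G u) (trans (lookup∘tabulate (adj u) v) uv)

  ∈nbhd⇒Adjacent : ∀ {u v} → v ∈ nbhd G u → Adjacent G u v
  ∈nbhd⇒Adjacent {u} {v} v∈N = trans (sym (lookup∘tabulate (adj u) v)) ([]=⇒lookup v∈N)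

  ∣p∩nbhd∣≡∑ : ∀ p u → ∣ p ∩ nbhd G u ∣ ≡ ∑[ x < n ] (𝟙 (lookup p x) * 𝟙 (adj u x))
  ∣p∩nbhd∣≡∑ p u = trans (∣p∣≡∑𝟙 (p ∩ nbhd G u)) (sum-cong-≗ {n} λ x → begin
    𝟙 (lookup (p ∩ nbhd G u) x)                ≡⟨ cong 𝟙 (lookup-zipWith _∧_ x p (nbhd G u)) ⟩
    𝟙 (lookup p x ∧ lookup (nbhd G u) x)       ≡⟨ cong (λ s → 𝟙 (lookup p x ∧ s)) (lookup∘tabulate (adj u) x) ⟩
    𝟙 (lookup p x ∧ adj u x)                   ≡⟨ 𝟙-∧ (lookup p x) (adj u x) ⟩
    𝟙 (lookup p x) * 𝟙 (adj u x)               ∎)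
    where open ≡-Reasoning

  ∑∣∩nbhd∣-comm : ∀ μ β → ∑[ u ∈ μ ] ∣ β ∩ nbhd G u ∣ ≡ ∑[ x ∈ β ] ∣ μ ∩ nbhd G x ∣
  ∑∣∩nbhd∣-comm μ β = begin
    ∑[ u < n ] (𝟙μ u * ∣ β ∩ nbhd G u ∣)
      ≡⟨ sum-cong-≗ {n} (λ u → cong (𝟙μ u *_) (∣p∩nbhd∣≡∑ β u)) ⟩
    ∑[ u < n ] (𝟙μ u * ∑[ x < n ] (𝟙β x * 𝟙 (adj u x)))
      ≡⟨ sum-cong-≗ {n} (λ u → *-distribˡ-sum (𝟙μ u) (λ x → 𝟙β x * 𝟙 (adj u x))) ⟩
    ∑[ u < n ] ∑[ x < n ] (𝟙μ u * (𝟙β x * 𝟙 (adj u x)))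
      ≡⟨ ∑-comm (λ u x → 𝟙μ u * (𝟙β x * 𝟙 (adj u x))) ⟩
    ∑[ x < n ] ∑[ u < n ] (𝟙μ u * (𝟙β x * 𝟙 (adj u x)))
      ≡⟨ sum-cong-≗ {n} (λ x → sum-cong-≗ {n} (λ u → swap x u)) ⟩
    ∑[ x < n ] ∑[ u < n ] (𝟙β x * (𝟙μ u * 𝟙 (adj x u)))
      ≡⟨ sum-cong-≗ {n} (λ x → *-distribˡ-sum (𝟙β x) (λ u → 𝟙μ u * 𝟙 (adj x u))) ⟨
    ∑[ x < n ] (𝟙β x * ∑[ u < n ] (𝟙μ u * 𝟙 (adj x u)))
      ≡⟨ sum-cong-≗ {n} (λ x → cong (𝟙β x *_) (∣p∩nbhd∣≡∑ μ x)) ⟨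
    ∑[ x < n ] (𝟙β x * ∣ μ ∩ nbhd G x ∣)
      ∎
    where
    open ≡-Reasoning
    𝟙μ 𝟙β : Fin n → ℕ
    𝟙μ u = 𝟙 (lookup μ u)
    𝟙β x = 𝟙 (lookup β x)
    swap : ∀ x u → 𝟙μ u * (𝟙β x * 𝟙 (adj u x)) ≡ 𝟙β x * (𝟙μ u * 𝟙 (adj x u))
    swap x u rewrite adj-sym u x = x∙yz≈y∙xz (𝟙μ u) (𝟙β x) (𝟙 (adj x u))

  -- Any a distinct vertices of β have at most c common neighbours in μ;
  -- distinctness comes from deleting each chosen vertex from β.
  CommonNeighbourBound : ℕ → Subset n → Subset n → ℕ → Set
  CommonNeighbourBound zero    μ β c = ∣ μ ∣ ≤ c
  CommonNeighbourBound (suc a) μ β c =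
    ∀ {x} → x ∈ β → CommonNeighbourBound a (μ ∩ nbhd G x) (β - x) c

  ∣μ∣*d↓a≤c*∣β∣^a : ∀ a {μ β d c} → (∀ {u} → u ∈ μ → d ≤ ∣ β ∩ nbhd G u ∣) →
                    CommonNeighbourBound a μ β c → ∣ μ ∣ * d ↓ a ≤ c * ∣ β ∣ ^ a
  ∣μ∣*d↓a≤c*∣β∣^a zero    _   ∣μ∣≤c = *-monoˡ-≤ 1 ∣μ∣≤c
  ∣μ∣*d↓a≤c*∣β∣^a (suc a) {μ} {β} {d} {c} deg bound = begin
    ∣ μ ∣ * (d * f)                    ≡⟨ *-assoc ∣ μ ∣ d f ⟨
    ∣ μ ∣ * d * f                      ≤⟨ *-monoˡ-≤ f ∣μ∣*d≤edges ⟩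
    (∑[ u ∈ μ ] ∣ β ∩ nbhd G u ∣) * f  ≡⟨ cong (_* f) (∑∣∩nbhd∣-comm μ β) ⟩
    (∑[ x ∈ β ] ∣ μ ∩ nbhd G x ∣) * f  ≡⟨ ∑∈-distribʳ β (λ x → ∣ μ ∩ nbhd G x ∣) f ⟩
    ∑[ x ∈ β ] (∣ μ ∩ nbhd G x ∣ * f)  ≤⟨ ∑∈-mono-≤ β ih ⟩
    ∑[ x ∈ β ] (c * ∣ β ∣ ^ a)         ≡⟨ ∑∈-const β (c * ∣ β ∣ ^ a) ⟩
    ∣ β ∣ * (c * ∣ β ∣ ^ a)            ≡⟨ x∙yz≈y∙xz ∣ β ∣ c (∣ β ∣ ^ a) ⟩
    c * (∣ β ∣ * ∣ β ∣ ^ a)            ∎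
    where
    open ≤-Reasoning
    f = (d ∸ 1) ↓ a
    ∣μ∣*d≤edges : ∣ μ ∣ * d ≤ ∑[ u ∈ μ ] ∣ β ∩ nbhd G u ∣
    ∣μ∣*d≤edges = subst (_≤ ∑[ u ∈ μ ] ∣ β ∩ nbhd G u ∣) (∑∈-const μ d) (∑∈-mono-≤ μ deg)
    ih : ∀ {x} → x ∈ β → ∣ μ ∩ nbhd G x ∣ * f ≤ c * ∣ β ∣ ^ a
    ih {x} x∈β = ≤-trans (∣μ∣*d↓a≤c*∣β∣^a a deg′ (bound x∈β))
                         (*-monoʳ-≤ c (^-monoˡ-≤ a (∣p─q∣≤∣p∣ β ⁅ x ⁆)))
      where
      deg′ : ∀ {u} → u ∈ μ ∩ nbhd G x → d ∸ 1 ≤ ∣ (β - x) ∩ nbhd G u ∣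
      deg′ {u} u∈ = ∸-monoˡ-≤ 1 (≤-trans (deg (p∩q⊆p μ (nbhd G x) u∈))
                                         (∣p∩q∣≤1+∣[p-x]∩q∣ β (nbhd G u) x))

  module _ {a b : ℕ} (free : KabFree G a b) where

    kabFree⇒commonNeighbourBound′ : ∀ a′ {k} (xs : Fin k → Fin n) → a′ + k ≡ a →
      Injective _≡_ _≡_ xs →
      ∀ {μ β} → (∀ {u} → u ∈ μ → ∀ i → Adjacent G (xs i) u) → (∀ i → xs i ∉ β) →
      CommonNeighbourBound a′ μ β (b ∸ 1)
    kabFree⇒commonNeighbourBound′ zero xs refl xs-inj {μ} μ-common _ with ∣ μ ∣ ≤? b ∸ 1
    ... | yes ∣μ∣≤b-1 = ∣μ∣≤b-1
    ... | no  ∣μ∣≰b-1 with injectionInto μ (≤-trans (m≤n+m∸n b 1) (≰⇒> ∣μ∣≰b-1))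
    ...   | ys , ys-inj , ys∈μ = ⊥-elim (free (xs , ys , xs-inj , ys-inj , disjoint , complete))
      where
      complete : ∀ i j → Adjacent G (xs i) (ys j)
      complete i j = μ-common (ys∈μ j) i
      disjoint : ∀ i j → xs i ≢ ys j
      disjoint i j xsi≡ysj
        with trans (sym (complete i j)) (trans (cong (λ w → adj w (ys j)) xsi≡ysj) (irrefl (ys j)))
      ... | ()
    kabFree⇒commonNeighbourBound′ (suc a′) {k} xs eq xs-inj {μ} {β} μ-common xs∉β {x} x∈β =
      kabFree⇒commonNeighbourBound′ a′ (x Vector.∷ xs) (trans (+-suc a′ k) eq)
        x∷xs-inj μ∩Nx-common x∷xs∉β-x
      where
      x∷xs-inj : Injective _≡_ _≡_ (x Vector.∷ xs)
      x∷xs-inj {zero}  {zero}  _ = refl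
      x∷xs-inj {zero}  {suc j} x≡xsj = ⊥-elim (xs∉β j (subst (_∈ β) x≡xsj x∈β))
      x∷xs-inj {suc i} {zero}  xsi≡x = ⊥-elim (xs∉β i (subst (_∈ β) (sym xsi≡x) x∈β))
      x∷xs-inj {suc i} {suc j} xsi≡xsj = cong suc (xs-inj xsi≡xsj)
      μ∩Nx-common : ∀ {u} → u ∈ μ ∩ nbhd G x → ∀ i → Adjacent G ((x Vector.∷ xs) i) u
      μ∩Nx-common u∈ zero    = ∈nbhd⇒Adjacent (p∩q⊆q μ (nbhd G x) u∈)
      μ∩Nx-common u∈ (suc i) = μ-common (p∩q⊆p μ (nbhd G x) u∈) i
      x∷xs∉β-x : ∀ i → (x Vector.∷ xs) i ∉ β - x
      x∷xs∉β-x zero    = x∉p-x β x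
      x∷xs∉β-x (suc i) = xs∉β i ∘ p─q⊆p β ⁅ x ⁆

    kabFree⇒commonNeighbourBound : ∀ μ β → CommonNeighbourBound a μ β (b ∸ 1)
    kabFree⇒commonNeighbourBound μ β =
      kabFree⇒commonNeighbourBound′ a (λ ()) (+-identityʳ a) (λ { {()} }) (λ _ ()) (λ ())

  ForceFrom : Subset n → Set
  ForceFrom X = ∃₂ λ u v → u ∈ X × v ∉ X × Adjacent G u v ×
                (∀ w → Adjacent G u w → w ≢ v → w ∈ X)

  forceFrom? : ∀ X → Dec (ForceFrom X)
  forceFrom? X = any? λ u → any? λ v →
    u ∈? X ×-dec ¬? (v ∈? X) ×-dec adj u v Bool.≟ true ×-dec
    all? λ w → adj u w Bool.≟ true →-dec ¬? (w ≟ v) →-dec w ∈? X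

  module _ {S : Subset n} where

    stalled⇒Black⊆ : ∀ {X v} → S ⊆ X → ¬ ForceFrom X → Black G S v → v ∈ X
    stalled⇒Black⊆ S⊆X _     (initial v∈S) = S⊆X v∈S
    stalled⇒Black⊆ {X} S⊆X stuck (force {u} {v} u-black uv others) with v ∈? X
    ... | yes v∈X = v∈X
    ... | no  v∉X = ⊥-elim (stuck (u , v , stalled⇒Black⊆ S⊆X stuck u-black , v∉X , uv ,
                                   λ w uw w≢v → stalled⇒Black⊆ S⊆X stuck (others w uw w≢v)))

    Black⇒Nonempty : ∀ {v} → Black G S v → Nonempty S
    Black⇒Nonempty (initial v∈S)     = _ , v∈S
    Black⇒Nonempty (force u-black _ _) = Black⇒Nonempty u-black

    module _ (zfs : IsZeroForcingSet G S) where

      forceFrom : ∀ {X} → S ⊆ X → ∣ X ∣ < n → ForceFrom X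
      forceFrom {X} S⊆X ∣X∣<n with forceFrom? X
      ... | yes step  = step
      ... | no  stuck = ⊥-elim (<⇒≱ ∣X∣<n (begin
        n          ≡⟨ ∣⊤∣≡n n ⟨
        ∣ ⊤ {n} ∣  ≤⟨ p⊆q⇒∣p∣≤∣q∣ {p = ⊤} (λ {v} _ → stalled⇒Black⊆ S⊆X stuck (zfs v)) ⟩
        ∣ X ∣      ∎))
        where open ≤-Reasoning

      forcingChain : ∀ k → ∣ S ∣ + k ≤ n → ∃₂ λ U X →
        S ⊆ X × ∣ X ∣ ≤ ∣ S ∣ + k × k ≤ ∣ U ∣ × (∀ {u} → u ∈ U → nbhd G u ⊆ X)
      forcingChain zero    _ =
        ⊥ , S , (λ v∈S → v∈S) , ≤-reflexive (sym (+-identityʳ ∣ S ∣)) , z≤n , λ u∈⊥ → ⊥-elim (∉⊥ u∈⊥)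
      forcingChain (suc k) z+k<n with forcingChain k (≤-trans (+-monoʳ-≤ ∣ S ∣ (n≤1+n k)) z+k<n)
      ... | U , X , S⊆X , ∣X∣≤z+k , k≤∣U∣ , U-closed
        with forceFrom S⊆X (≤-<-trans ∣X∣≤z+k (≤-trans (≤-reflexive (sym (+-suc ∣ S ∣ k))) z+k<n))
      ...   | u , v , u∈X , v∉X , uv , others =
        U ∪ ⁅ u ⁆ , X ∪ ⁅ v ⁆ , p⊆p∪q ⁅ v ⁆ ∘ S⊆X , ∣X′∣≤ ,
        ≤-trans (s≤s k≤∣U∣) (x∉p⇒∣p∣<∣p∪⁅x⁆∣ u∉U) , U′-closed
        where
        u∉U : u ∉ U
        u∉U u∈U = v∉X (U-closed u∈U (Adjacent⇒∈nbhd uv))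
        ∣X′∣≤ : ∣ X ∪ ⁅ v ⁆ ∣ ≤ ∣ S ∣ + suc k
        ∣X′∣≤ = ≤-trans (∣p∪⁅x⁆∣≤1+∣p∣ X v) (≤-trans (s≤s ∣X∣≤z+k) (≤-reflexive (sym (+-suc ∣ S ∣ k))))
        U′-closed : ∀ {y} → y ∈ U ∪ ⁅ u ⁆ → nbhd G y ⊆ X ∪ ⁅ v ⁆
        U′-closed {y} y∈ {w} w∈Ny with x∈p∪q⁻ U ⁅ u ⁆ y∈
        ... | inj₁ y∈U = p⊆p∪q ⁅ v ⁆ (U-closed y∈U w∈Ny)
        ... | inj₂ y∈⁅u⁆ with x∈⁅y⁆⇒x≡y u y∈⁅u⁆ | w ≟ v
        ...   | refl | yes refl = x∈p∪q⁺ (inj₂ (x∈⁅x⁆ v))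
        ...   | refl | no  w≢v  = x∈p∪q⁺ (inj₁ (others w (∈nbhd⇒Adjacent w∈Ny) w≢v))

      0<∣S∣ : Fin n → 0 < ∣ S ∣
      0<∣S∣ v with Black⇒Nonempty (zfs v)
      ... | x , x∈S = ≤-trans (s≤s z≤n) (x∈p⇒∣p-x∣<∣p∣ x∈S)

      closedPair : Fin n → ∃₂ λ U X →
        0 < ∣ U ∣ × ∣ X ∣ ≤ 2 * ∣ U ∣ × ∣ X ∣ ≤ 2 * ∣ S ∣ × (∀ {u} → u ∈ U → nbhd G u ⊆ X)
      closedPair v with 2 * ∣ S ∣ ≤? n
      ... | yes 2z≤n with forcingChain ∣ S ∣ (subst (_≤ n) (2*m≡m+m ∣ S ∣) 2z≤n)
      ...   | U , X , _ , ∣X∣≤z+z , z≤∣U∣ , U-closed =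
        U , X , <-≤-trans (0<∣S∣ v) z≤∣U∣ , ≤-trans ∣X∣≤2z (*-monoʳ-≤ 2 z≤∣U∣) , ∣X∣≤2z , U-closed
        where
        ∣X∣≤2z : ∣ X ∣ ≤ 2 * ∣ S ∣
        ∣X∣≤2z = subst (∣ X ∣ ≤_) (sym (2*m≡m+m ∣ S ∣)) ∣X∣≤z+z
      closedPair v | no 2z≰n = ⊤ , ⊤ , subst (0 <_) (sym (∣⊤∣≡n n)) 0<n , m≤m+n ∣ ⊤ {n} ∣ _ ,
                      subst (_≤ 2 * ∣ S ∣) (sym (∣⊤∣≡n n)) (<⇒≤ (≰⇒> 2z≰n)) , λ _ → ⊆⊤
        where
        0<n : 0 < n
        0<n = ≤-trans (s≤s z≤n) (toℕ<n v)

  module _ {a b : ℕ} (free : KabFree G (suc a) b) {δ : ℕ} (δ≤deg : ∀ v → δ ≤ degree G v)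
           {S : Subset n} (zfs : IsZeroForcingSet G S) where

    δ↓[1+a]≤2[b∸1][2∣S∣]^a : Fin n → δ ↓ suc a ≤ 2 * (b ∸ 1) * (2 * ∣ S ∣) ^ a
    δ↓[1+a]≤2[b∸1][2∣S∣]^a v with closedPair zfs v
    ... | U , X , 0<∣U∣ , ∣X∣≤2∣U∣ , ∣X∣≤2z , U-closed =
      *-cancelˡ-≤ ∣ U ∣ {{>-nonZero 0<∣U∣}} (begin
        ∣ U ∣ * δ ↓ suc a
          ≤⟨ ∣μ∣*d↓a≤c*∣β∣^a (suc a) deg (kabFree⇒commonNeighbourBound free U X) ⟩
        c * (∣ X ∣ * ∣ X ∣ ^ a)
          ≤⟨ *-monoʳ-≤ c (*-mono-≤ ∣X∣≤2∣U∣ (^-monoˡ-≤ a ∣X∣≤2z)) ⟩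
        c * (2 * ∣ U ∣ * (2 * ∣ S ∣) ^ a)
          ≡⟨ solve 3 (λ c u p → c :* (con 2 :* u :* p) := u :* (con 2 :* c :* p)) refl c ∣ U ∣ ((2 * ∣ S ∣) ^ a) ⟩
        ∣ U ∣ * (2 * c * (2 * ∣ S ∣) ^ a)
          ∎)
      where
      open ≤-Reasoning
      c = b ∸ 1
      deg : ∀ {u} → u ∈ U → δ ≤ ∣ X ∩ nbhd G u ∣
      deg {u} u∈U = ≤-trans (δ≤deg u) (p⊆q⇒∣p∣≤∣q∣ λ w∈Nu → x∈p∩q⁺ (U-closed u∈U w∈Nu , w∈Nu))

corollary2p2 : (a b : ℕ) → 1 ≤ a → a ≤ b →
    (G : Graph) → KabFree G a b →
    (δ : ℕ) → IsMinDegree G δ → 4 * a ∸ 4 ≤ δ →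
    (z : ℕ) → IsZeroForcingNumber G z →
    δ ^ a ≤ (2 * z) ^ (a ∸ 1) * 4 ^ a * (b ∸ 1)
-- The bound holds for every zero forcing set.
corollary2p2 (suc a) b (s≤s z≤n) _ G free δ ((v , _) , δ≤deg) 4a≤δ _ ((S , zfs , refl) , _) =
  *-cancelˡ-≤ 2 (begin
    2 * δ ^ suc a
      ≤⟨ *-monoˡ-≤ (δ ^ suc a) (m≤m+n 2 2) ⟩
    4 * δ ^ suc a
      ≤⟨ 4*^≤4^*↓ a δ (subst (_≤ δ) 4[1+a]∸4≡4a 4a≤δ) ⟩
    4 ^ suc a * δ ↓ suc a
      ≤⟨ *-monoʳ-≤ (4 ^ suc a) (δ↓[1+a]≤2[b∸1][2∣S∣]^a G free δ≤deg zfs v) ⟩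
    4 ^ suc a * (2 * c * (2 * ∣ S ∣) ^ a)
      ≡⟨ solve 3 (λ p c w → p :* (con 2 :* c :* w) := con 2 :* (w :* p :* c)) refl (4 ^ suc a) c ((2 * ∣ S ∣) ^ a) ⟩
    2 * ((2 * ∣ S ∣) ^ a * 4 ^ suc a * c)
      ∎)
  where
  open ≤-Reasoning
  c = b ∸ 1
  4[1+a]∸4≡4a : 4 * suc a ∸ 4 ≡ 4 * a
  4[1+a]∸4≡4a = trans (cong (_∸ 4) (*-suc 4 a)) (m+n∸m≡n 4 (4 * a))
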